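{- Let $T$ be a binary tree and $L_1,L_2,L'\subseteq\mathcal{L}(T)$ with $L_1\cup L_2\subseteq L'$. Then $T|L_1$ and $T|L_2$ are edge disjoint if and only if $\mathrm{path}_{T|L'}(u_1,v_1)\cap\mathrm{path}_{T|L'}(u_2,v_2)=\emptyset$ for all $u_1,v_1\in L_1$ and $u_2,v_2\in L_2$. In particular, $T|L_1$ and $T|L_2$ are edge disjoint if and only if $\mathrm{path}_{T|L_1\cup L_2}(u_1,v_1)\cap\mathrm{path}_{T|L_1\cup L_2}(u_2,v_2)=\emptyset$ for all $u_1,v_1\in L_1$ and $u_2,v_2\in L_2$.
   Context: A binary tree has all internal vertices of degree $3$ and labeled leaves $\mathcal{L}(T)$. $\mathrm{path}_T(x,y)$ is the set of edges on the path from $x$ to $y$ in $T$. For $L\subseteq\mathcal{L}(T)$, the restriction $T|L$ is the tree with leaf set $L$ whose splits are $\{(B\cap L)|(B'\cap L): B|B'\in\Sigma(T)\}$, where $\Sigma(T)$ is the set of bipartitions of $\mathcal{L}(T)$ obtained by deleting one edge of $T$; equivalently, $T|L$ is obtained from the minimal subtree of $T$ spanning $L$ by suppressing degree-2 vertices. For $L_1,L_2\subseteq\mathcal{L}(T)$, $T|L_1$ and $T|L_2$ are edge disjoint if $\mathrm{path}_T(u_1,v_1)\cap\mathrm{path}_T(u_2,v_2)=\emptyset$ for all $u_1,v_1\in L_1$, $u_2,v_2\in L_2$, and edge sharing otherwise. -}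

module Defs where

open import Level using (0ℓ)
open import Data.Nat using (ℕ; _≤_)
open import Data.Bool using (Bool; true; false)
open import Data.Fin using (Fin)
open import Data.List using (List; []; _∷_; _++_; length; filterᵇ; allFin)
open import Data.List.Relation.Unary.Unique.Propositional using (Unique)
open import Data.Product using (Σ; ∃; ∃-syntax; _×_; _,_)
open import Data.Sum using (_⊎_)
open import Relation.Nullary using (¬_)
open import Relation.Binary.PropositionalEquality using (_≡_)
open import Relation.Unary using (Pred; _⊆_; _∪_; _∩_; _≐_; Satisfiable; _∈_)

module _ {n : ℕ} (adj : Fin n → Fin n → Bool) where

  degree : Fin n → ℕ
  degree x = length (filterᵇ (adj x) (allFin n))

  data Walk : Fin n → Fin n → List (Fin n) → Set where
    stop : ∀ x → Walk x x (x ∷ [])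
    step : ∀ {x y z p} → adj x y ≡ true → Walk y z p → Walk x z (x ∷ p)

  IsPath : Fin n → Fin n → List (Fin n) → Set
  IsPath x y p = Walk x y p × Unique p

Consec : {A : Set} → A → A → List A → Set
Consec a b p = ∃[ xs ] ∃[ ys ] p ≡ xs ++ a ∷ b ∷ ys

EdgeOn : {A : Set} → A → A → List A → Set
EdgeOn a b p = Consec a b p ⊎ Consec b a p

-- Leaves are the vertices of degree ≤ 1
-- (degree 0 only in the one-vertex tree); leaves carry distinct labels.

record Tree : Set where
  field
    n       : ℕ
    adj     : Fin n → Fin n → Bool
    adj-sym : ∀ x y → adj x y ≡ adj y x
    adj-irr : ∀ x → adj x x ≡ false
    connected   : ∀ x y → ∃[ p ] IsPath adj x y p
    uniquePaths : ∀ x y p q → IsPath adj x y p → IsPath adj x y q → p ≡ q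
    lab     : Fin n → ℕ
  IsLeaf : Fin n → Set
  IsLeaf x = degree adj x ≤ 1
  field
    lab-inj : ∀ x y → IsLeaf x → IsLeaf y → lab x ≡ lab y → x ≡ y

open Tree public

Binary : Tree → Set
Binary T = ∀ x → ¬ IsLeaf T x → degree (adj T) x ≡ 3

ℒ : Tree → Pred ℕ 0ℓ
ℒ T l = ∃[ x ] IsLeaf T x × lab T x ≡ l

OnPathV : (T : Tree) → Fin (n T) → Fin (n T) → Fin (n T) → Fin (n T) → Set
OnPathV T x y a b = ∃[ p ] IsPath (adj T) x y p × EdgeOn a b p

OnPath : (T : Tree) → ℕ → ℕ → Fin (n T) → Fin (n T) → Set
OnPath T u v a b =
  ∃[ x ] ∃[ y ] (IsLeaf T x × lab T x ≡ u × IsLeaf T y × lab T y ≡ v × OnPathV T x y a b)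

-- For L1, L2 ⊆ ℒ(T) this is the definition of T|L1 and T|L2 being
-- edge disjoint; applied to a tree realising T|L' it is the right-hand
-- side of the lemma.
PathsDisjoint : Tree → Pred ℕ 0ℓ → Pred ℕ 0ℓ → Set
PathsDisjoint T L₁ L₂ =
  ∀ u₁ v₁ u₂ v₂ → u₁ ∈ L₁ → v₁ ∈ L₁ → u₂ ∈ L₂ → v₂ ∈ L₂ →
  ∀ a b → ¬ (OnPath T u₁ v₁ a b × OnPath T u₂ v₂ a b)

EdgeDisjoint : Tree → Pred ℕ 0ℓ → Pred ℕ 0ℓ → Set
EdgeDisjoint T L₁ L₂ = PathsDisjoint T L₁ L₂

Side : (T : Tree) → Fin (n T) → Fin (n T) → Pred ℕ 0ℓ
Side T a b l = ∃[ x ] IsLeaf T x × lab T x ≡ l ×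
               ∃[ p ] IsPath (adj T) a x p × ¬ EdgeOn a b p

SameSplit : Pred ℕ 0ℓ → Pred ℕ 0ℓ → Pred ℕ 0ℓ → Pred ℕ 0ℓ → Set
SameSplit A A' C C' = (A ≐ C × A' ≐ C') ⊎ (A ≐ C' × A' ≐ C)

-- R is (a realisation of) the restriction T|L: its leaf set is L and
-- Σ(R) = { (B∩L)|(B'∩L) : B|B' ∈ Σ(T) }, where only bipartitions with
-- both parts nonempty count as splits.
IsRestriction : Tree → Pred ℕ 0ℓ → Tree → Set
IsRestriction T L R =
  (ℒ R ≐ L) ×
  (∀ c d → adj R c d ≡ true →
     ∃[ a ] ∃[ b ] adj T a b ≡ true ×
       SameSplit (Side R c d) (Side R d c) (Side T a b ∩ L) (Side T b a ∩ L)) ×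
  (∀ a b → adj T a b ≡ true →
     Satisfiable (Side T a b ∩ L) → Satisfiable (Side T b a ∩ L) →
     ∃[ c ] ∃[ d ] adj R c d ≡ true ×
       SameSplit (Side R c d) (Side R d c) (Side T a b ∩ L) (Side T b a ∩ L))

-- An edge {a,b} of a tree lies on the path between two leaves exactly when
-- it separates them: one leaf is on the a-side and the other on the b-side,
-- sides being read off the unique paths from a and from b. By definition of
-- the restriction, the edges of T|L' carry exactly the splits of T restricted
-- to L' with both parts nonempty. So an edge of T|L' common to two of its
-- paths gives an edge of T separating both pairs of leaves; conversely an
-- edge of T common to two paths between leaves of L' induces a split of L'
-- with both parts nonempty, hence an edge of T|L' on both corresponding paths.
module Submission where

open import Defs
open import Level using (0ℓ)
open import Data.Nat using (ℕ)
open import Data.Product using (_×_; ∃-syntax; _,_; proj₁; proj₂)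
open import Function.Bundles using (_⇔_; mk⇔)
open import Relation.Unary using (Pred; _⊆_; _∪_; _∩_; Satisfiable)

open import Data.Bool using (Bool; true)
open import Data.Empty using (⊥-elim)
open import Data.Fin using (Fin)
open import Data.Fin.Properties using (_≟_)
open import Data.Sum using (_⊎_; inj₁; inj₂)
open import Data.List using (List; []; _∷_; _++_; [_]; _∷ʳ_; reverse)
open import Data.List.Properties
  using (∷-injectiveˡ; ++-assoc; reverse-++; unfold-reverse; ∷ʳ-++; ∷ʳ-injectiveˡ)
open import Data.List.Membership.Propositional using (_∈_; _∉_)
open import Data.List.Membership.Propositional.Properties using (∈-∃++; ∈-++⁺ˡ; ∈-++⁺ʳ)
open import Data.List.Relation.Unary.Any using (here; there)
open import Data.List.Relation.Unary.Any.Properties using (reverse⁻)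
open import Data.List.Relation.Unary.All using ([]; _∷_)
open import Data.List.Relation.Unary.All.Properties using (++⁻ˡ; ¬Any⇒All¬)
open import Data.List.Relation.Unary.AllPairs using ([]; _∷_)
open import Data.List.Relation.Unary.Unique.Propositional using (Unique)
open import Data.List.Relation.Unary.Unique.Propositional.Properties
  using (++⁺; Unique[x∷xs]⇒x∉xs)
open import Data.List.Relation.Binary.Disjoint.Propositional using (Disjoint)
open import Data.List.Relation.Binary.Permutation.Propositional using (↭-sym; ↭⇒↭ₛ)
open import Data.List.Relation.Binary.Permutation.Propositional.Properties using (↭-reverse)
import Data.List.Relation.Binary.Permutation.Setoid.Properties as ↭ₛ
open import Function using (id; _∘_; case_of_)
open import Relation.Nullary using (¬_; yes; no)
open import Relation.Unary.Properties using (≐-sym)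
open import Relation.Binary.PropositionalEquality
  using (_≡_; _≢_; refl; sym; trans; cong; subst; setoid; module ≡-Reasoning)

module _ {A : Set} where

  Unique-++⁻ˡ : ∀ (xs : List A) {ys} → Unique (xs ++ ys) → Unique xs
  Unique-++⁻ˡ []       _          = []
  Unique-++⁻ˡ (_ ∷ xs) (x∉ ∷ uniq) = ++⁻ˡ xs x∉ ∷ Unique-++⁻ˡ xs uniq

  Unique-++⁻ʳ : ∀ (xs : List A) {ys} → Unique (xs ++ ys) → Unique ys
  Unique-++⁻ʳ []       uniq       = uniq
  Unique-++⁻ʳ (_ ∷ xs) (_ ∷ uniq) = Unique-++⁻ʳ xs uniq

  Unique-reverse : ∀ {xs : List A} → Unique xs → Unique (reverse xs)
  Unique-reverse {xs} = ↭ₛ.Unique-resp-↭ (setoid A) (↭⇒↭ₛ (↭-sym (↭-reverse xs)))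

  ∈-prefix : ∀ xs {v : A} {ys z} → z ∈ xs ∷ʳ v → z ∈ xs ++ v ∷ ys
  ∈-prefix xs {v} {ys} z∈ = subst (_ ∈_) (∷ʳ-++ xs v ys) (∈-++⁺ˡ z∈)

  Unique-prefix : ∀ xs {v : A} {ys} → Unique (xs ++ v ∷ ys) → Unique (xs ∷ʳ v)
  Unique-prefix xs {v} {ys} uniq =
    Unique-++⁻ˡ (xs ∷ʳ v) (subst Unique (sym (∷ʳ-++ xs v ys)) uniq)

  Consec-reverse : ∀ {a b : A} {p} → Consec b a p → Consec a b (reverse p)
  Consec-reverse {a} {b} (xs , ys , refl) = reverse ys , reverse xs , reverse-middle
    where
    open ≡-Reasoning
    reverse-middle : reverse (xs ++ b ∷ a ∷ ys) ≡ reverse ys ++ a ∷ b ∷ reverse xs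
    reverse-middle = begin
      reverse (xs ++ b ∷ a ∷ ys)                   ≡⟨ reverse-++ xs (b ∷ a ∷ ys) ⟩
      reverse (b ∷ a ∷ ys) ++ reverse xs           ≡⟨ cong (_++ reverse xs) (reverse-++ (b ∷ a ∷ []) ys) ⟩
      (reverse ys ++ a ∷ b ∷ []) ++ reverse xs     ≡⟨ ++-assoc (reverse ys) (a ∷ b ∷ []) (reverse xs) ⟩
      reverse ys ++ a ∷ b ∷ reverse xs             ∎

  EdgeOn-sym : ∀ {a b : A} {p} → EdgeOn a b p → EdgeOn b a p
  EdgeOn-sym (inj₁ ab) = inj₂ ab
  EdgeOn-sym (inj₂ ba) = inj₁ ba

  EdgeOn-∈ʳ : ∀ {a b : A} {p} → EdgeOn a b p → b ∈ p
  EdgeOn-∈ʳ (inj₁ (xs , _ , refl)) = ∈-++⁺ʳ xs (there (here refl))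
  EdgeOn-∈ʳ (inj₂ (xs , _ , refl)) = ∈-++⁺ʳ xs (here refl)

  EdgeOn-head : ∀ {a b : A} {t} → a ≢ b → Unique (a ∷ t) → EdgeOn a b (a ∷ t) →
                ∃[ ys ] t ≡ b ∷ ys
  EdgeOn-head _   _    (inj₁ ([] , ys , refl)) = ys , refl
  EdgeOn-head a≢b _    (inj₂ ([] , _ , refl))  = ⊥-elim (a≢b refl)
  EdgeOn-head _   uniq (inj₁ (_ ∷ xs , _ , refl)) =
    ⊥-elim (Unique[x∷xs]⇒x∉xs uniq (∈-++⁺ʳ xs (here refl)))
  EdgeOn-head _   uniq (inj₂ (_ ∷ xs , _ , refl)) =
    ⊥-elim (Unique[x∷xs]⇒x∉xs uniq (∈-++⁺ʳ xs (there (here refl))))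

module _ {m : ℕ} {E : Fin m → Fin m → Bool} where

  Walk-head : ∀ {x y p} → Walk E x y p → ∃[ t ] p ≡ x ∷ t
  Walk-head (stop _)   = [] , refl
  Walk-head (step _ _) = _ , refl

  Walk-source∈ : ∀ {x y p} → Walk E x y p → x ∈ p
  Walk-source∈ (stop _)   = here refl
  Walk-source∈ (step _ _) = here refl

  Walk-join : ∀ {x a b y p q} → Walk E x a p → E a b ≡ true → Walk E b y q →
              Walk E x y (p ++ q)
  Walk-join (stop _)     ab w = step ab w
  Walk-join (step xz w′) ab w = step xz (Walk-join w′ ab w)

  Walk-drop : ∀ {x y v} xs {ys} → Walk E x y (xs ++ v ∷ ys) → Walk E v y (v ∷ ys)
  Walk-drop []           (stop _)   = stop _
  Walk-drop []           (step h w) = step h w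
  Walk-drop (_ ∷ [])     (step _ w) = Walk-drop [] w
  Walk-drop (_ ∷ z ∷ xs) (step _ w) = Walk-drop (z ∷ xs) w

  Walk-take : ∀ {x y v} xs {ys} → Walk E x y (xs ++ v ∷ ys) → Walk E x v (xs ∷ʳ v)
  Walk-take []           (stop _)   = stop _
  Walk-take []           (step _ _) = stop _
  Walk-take (_ ∷ [])     (step h w) = step h (Walk-take [] w)
  Walk-take (_ ∷ z ∷ xs) (step h w) = step h (Walk-take (z ∷ xs) w)

  Walk-Consec⇒adj : ∀ {x y p a b} → Walk E x y p → Consec a b p → E a b ≡ true
  Walk-Consec⇒adj w (xs , _ , refl) = first-step (Walk-drop xs w)
    where
    first-step : ∀ {a b y ys} → Walk E a y (a ∷ b ∷ ys) → E a b ≡ true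
    first-step (step h (stop _))   = h
    first-step (step h (step _ _)) = h

data Separates {a ℓ} {X : Set a} (P Q : Pred X ℓ) (x y : X) : Set ℓ where
  left-right : P x → Q y → Separates P Q x y
  right-left : Q x → P y → Separates P Q x y

module _ (T : Tree) where

  private
    V = Fin (n T)
    E = adj T

  adj-flip : ∀ {a b} → E a b ≡ true → E b a ≡ true
  adj-flip {a} {b} h = trans (adj-sym T b a) h

  adj⇒≢ : ∀ {a b} → E a b ≡ true → a ≢ b
  adj⇒≢ {a} h refl with trans (sym h) (adj-irr T a)
  ... | ()

  Walk-reverse : ∀ {x y p} → Walk E x y p → Walk E y x (reverse p)
  Walk-reverse (stop x) = stop x
  Walk-reverse {x} (step {p = p} h w) =
    subst (Walk E _ x) (sym (unfold-reverse x p)) (Walk-join (Walk-reverse w) (adj-flip h) (stop x))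

  IsPath-reverse : ∀ {x y p} → IsPath E x y p → IsPath E y x (reverse p)
  IsPath-reverse (w , uniq) = Walk-reverse w , Unique-reverse uniq

  IsPath-drop : ∀ {x y v} xs {ys} → IsPath E x y (xs ++ v ∷ ys) → IsPath E v y (v ∷ ys)
  IsPath-drop xs (w , uniq) = Walk-drop xs w , Unique-++⁻ʳ xs uniq

  IsPath-take : ∀ {x y v} xs {ys} → IsPath E x y (xs ++ v ∷ ys) → IsPath E x v (xs ∷ʳ v)
  IsPath-take xs (w , uniq) = Walk-take xs w , Unique-prefix xs uniq

  IsPath-cons : ∀ {a b y p} → E b a ≡ true → b ∉ p → IsPath E a y p → IsPath E b y (b ∷ p)
  IsPath-cons ba b∉p (w , uniq) = step ba w , ¬Any⇒All¬ _ b∉p ∷ uniq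

  IsPath-edge : ∀ {a b} → E a b ≡ true → IsPath E a b (a ∷ b ∷ [])
  IsPath-edge ab = step ab (stop _) , (adj⇒≢ ab ∷ []) ∷ [] ∷ []

  OnSide : V → V → V → Set
  OnSide a b x = ∃[ p ] IsPath E a x p × ¬ EdgeOn a b p

  ¬EdgeOn⇒∉ : ∀ {a b z p} → E a b ≡ true → IsPath E a z p → ¬ EdgeOn a b p → b ∉ p
  ¬EdgeOn⇒∉ {a} {b} ab path ¬ab b∈p with ∈-∃++ b∈p
  ... | pre , post , refl = ¬ab (inj₁ ([] , post , cong (_++ b ∷ post) pre≡[a]))
    where
    pre≡[a] : pre ≡ [ a ]
    pre≡[a] = ∷ʳ-injectiveˡ pre [ a ] (uniquePaths T a b _ _ (IsPath-take pre path) (IsPath-edge ab))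

  OnSide-byFirstStep : ∀ {a b x} → E a b ≡ true → ∀ t → IsPath E a x (a ∷ t) →
                       OnSide a b x ⊎ OnSide b a x
  OnSide-byFirstStep ab [] path =
    inj₁ (_ , path , λ e → case proj₂ (EdgeOn-head (adj⇒≢ ab) (proj₂ path) e) of λ ())
  OnSide-byFirstStep {a} {b} ab (c ∷ ys) path with c ≟ b
  ... | yes refl = inj₂ (_ , IsPath-drop [ a ] path ,
                         λ e → Unique[x∷xs]⇒x∉xs (proj₂ path) (EdgeOn-∈ʳ e))
  ... | no c≢b   = inj₁ (_ , path ,
                         λ e → c≢b (∷-injectiveˡ (proj₂ (EdgeOn-head (adj⇒≢ ab) (proj₂ path) e))))

  OnSide-total : ∀ {a b} → E a b ≡ true → ∀ x → OnSide a b x ⊎ OnSide b a x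
  OnSide-total {a} ab x with connected T a x
  ... | p , path with Walk-head (proj₁ path)
  ... | t , refl = OnSide-byFirstStep ab t path

  OnSide⇒¬Consec : ∀ {a b x y p} → OnSide a b y → IsPath E x y p → ¬ Consec a b p
  OnSide⇒¬Consec {a} {b} {y = y} (q , pathq , ¬ab) path (xs , ys , refl) =
    ¬ab (subst (EdgeOn a b) (uniquePaths T a y _ _ (IsPath-drop xs path) pathq)
               (inj₁ ([] , ys , refl)))

  sameSide⇒¬EdgeOn : ∀ {a b x y p} → OnSide a b x → OnSide a b y → IsPath E x y p →
                     ¬ EdgeOn a b p
  sameSide⇒¬EdgeOn sx sy path (inj₁ ab) = OnSide⇒¬Consec sy path ab
  sameSide⇒¬EdgeOn sx sy path (inj₂ ba) =
    OnSide⇒¬Consec sx (IsPath-reverse path) (Consec-reverse ba)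

  EdgeOn⇒Separates : ∀ {a b x y p} → E a b ≡ true → IsPath E x y p → EdgeOn a b p →
                     Separates (OnSide a b) (OnSide b a) x y
  EdgeOn⇒Separates {x = x} {y} ab path e with OnSide-total ab x | OnSide-total ab y
  ... | inj₁ sx | inj₁ sy = ⊥-elim (sameSide⇒¬EdgeOn sx sy path e)
  ... | inj₂ sx | inj₂ sy = ⊥-elim (sameSide⇒¬EdgeOn sx sy path (EdgeOn-sym e))
  ... | inj₁ sx | inj₂ sy = left-right sx sy
  ... | inj₂ sx | inj₁ sy = right-left sx sy

  -- A common vertex v would give two paths from b to v: b followed by the
  -- path from a to v, which contains a, and the one along q, which does not.
  oppositeSides-disjoint : ∀ {a b x y p q} → E a b ≡ true →
                           IsPath E a x p → ¬ EdgeOn a b p →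
                           IsPath E b y q → ¬ EdgeOn b a q → Disjoint p q
  oppositeSides-disjoint {a} {b} ab pathp ¬ab pathq ¬ba {v} (v∈p , v∈q)
    with ∈-∃++ v∈p | ∈-∃++ v∈q
  ... | pre₁ , _ , refl | pre₂ , _ , refl =
    ¬EdgeOn⇒∉ (adj-flip ab) pathq ¬ba (∈-prefix pre₂ (subst (a ∈_) same a∈))
    where
    path-av = IsPath-take pre₁ pathp
    path-bv = IsPath-cons (adj-flip ab) (¬EdgeOn⇒∉ ab pathp ¬ab ∘ ∈-prefix pre₁) path-av
    same : b ∷ pre₁ ∷ʳ v ≡ pre₂ ∷ʳ v
    same = uniquePaths T b v _ _ path-bv (IsPath-take pre₂ pathq)
    a∈ : a ∈ b ∷ pre₁ ∷ʳ v
    a∈ = there (Walk-source∈ (proj₁ path-av))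

  oppositeSides⇒OnPathV : ∀ {a b x y} → E a b ≡ true → OnSide a b x → OnSide b a y →
                          OnPathV T x y a b
  oppositeSides⇒OnPathV {a} {b} {x} {y} ab (_ , pathp , ¬ab) (_ , pathq , ¬ba)
    with Walk-head (proj₁ pathp) | Walk-head (proj₁ pathq)
  ... | t , refl | s , refl =
    reverse (a ∷ t) ++ b ∷ s , (walk , unique) , inj₁ (reverse t , s , crossing)
    where
    walk : Walk E x y (reverse (a ∷ t) ++ b ∷ s)
    walk = Walk-join (Walk-reverse (proj₁ pathp)) ab (proj₁ pathq)
    unique : Unique (reverse (a ∷ t) ++ b ∷ s)
    unique = ++⁺ (Unique-reverse (proj₂ pathp)) (proj₂ pathq) λ (v∈ , v∈′) →
      oppositeSides-disjoint ab pathp ¬ab pathq ¬ba (reverse⁻ v∈ , v∈′)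
    crossing : reverse (a ∷ t) ++ b ∷ s ≡ reverse t ++ a ∷ b ∷ s
    crossing = trans (cong (_++ b ∷ s) (unfold-reverse a t)) (∷ʳ-++ (reverse t) a (b ∷ s))

  Separates⇒OnPathV : ∀ {a b x y} → E a b ≡ true → Separates (OnSide a b) (OnSide b a) x y →
                      OnPathV T x y a b
  Separates⇒OnPathV ab (left-right sx sy) = oppositeSides⇒OnPathV ab sx sy
  Separates⇒OnPathV ab (right-left sx sy) with oppositeSides⇒OnPathV (adj-flip ab) sx sy
  ... | p , path , e = p , path , EdgeOn-sym e

  OnPath⇒adj : ∀ {u v a b} → OnPath T u v a b → E a b ≡ true
  OnPath⇒adj (_ , _ , _ , _ , _ , _ , _ , path , inj₁ ab) = Walk-Consec⇒adj (proj₁ path) ab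
  OnPath⇒adj (_ , _ , _ , _ , _ , _ , _ , path , inj₂ ba) = adj-flip (Walk-Consec⇒adj (proj₁ path) ba)

  OnPath⇒Separates : ∀ {u v a b} → OnPath T u v a b → Separates (Side T a b) (Side T b a) u v
  OnPath⇒Separates o@(x , y , leaf-x , lab-x , leaf-y , lab-y , _ , path , e)
    with EdgeOn⇒Separates (OnPath⇒adj o) path e
  ... | left-right sx sy = left-right (x , leaf-x , lab-x , sx) (y , leaf-y , lab-y , sy)
  ... | right-left sx sy = right-left (x , leaf-x , lab-x , sx) (y , leaf-y , lab-y , sy)

  Separates⇒OnPath : ∀ {u v a b} → E a b ≡ true → Separates (Side T a b) (Side T b a) u v →
                     OnPath T u v a b
  Separates⇒OnPath ab (left-right (x , leaf-x , lab-x , sx) (y , leaf-y , lab-y , sy)) =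
    x , y , leaf-x , lab-x , leaf-y , lab-y , Separates⇒OnPathV ab (left-right sx sy)
  Separates⇒OnPath ab (right-left (x , leaf-x , lab-x , sx) (y , leaf-y , lab-y , sy)) =
    x , y , leaf-x , lab-x , leaf-y , lab-y , Separates⇒OnPathV ab (right-left sx sy)

module _ {a ℓ} {X : Set a} {P Q : Pred X ℓ} {x y : X} where

  Separates-∩⁺ : ∀ {L : Pred X ℓ} → Separates P Q x y → L x → L y → Separates (P ∩ L) (Q ∩ L) x y
  Separates-∩⁺ (left-right px qy) Lx Ly = left-right (px , Lx) (qy , Ly)
  Separates-∩⁺ (right-left qx py) Lx Ly = right-left (qx , Lx) (py , Ly)

  Separates-∩⁻ : ∀ {L : Pred X ℓ} → Separates (P ∩ L) (Q ∩ L) x y → Separates P Q x y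
  Separates-∩⁻ (left-right (px , _) (qy , _)) = left-right px qy
  Separates-∩⁻ (right-left (qx , _) (py , _)) = right-left qx py

  Separates⇒Satisfiable : Separates P Q x y → Satisfiable P × Satisfiable Q
  Separates⇒Satisfiable (left-right px qy) = (x , px) , (y , qy)
  Separates⇒Satisfiable (right-left qx py) = (y , py) , (x , qx)

module _ {P P′ Q Q′ : Pred ℕ 0ℓ} where

  SameSplit-sym : SameSplit P P′ Q Q′ → SameSplit Q Q′ P P′
  SameSplit-sym (inj₁ (P≐Q , P′≐Q′)) = inj₁ (≐-sym P≐Q , ≐-sym P′≐Q′)
  SameSplit-sym (inj₂ (P≐Q′ , P′≐Q)) = inj₂ (≐-sym P′≐Q , ≐-sym P≐Q′)

  SameSplit⇒Separates : ∀ {u v} → SameSplit P P′ Q Q′ → Separates P P′ u v → Separates Q Q′ u v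
  SameSplit⇒Separates (inj₁ ((P⊆Q , _) , (P′⊆Q′ , _))) (left-right pu p′v) =
    left-right (P⊆Q pu) (P′⊆Q′ p′v)
  SameSplit⇒Separates (inj₁ ((P⊆Q , _) , (P′⊆Q′ , _))) (right-left p′u pv) =
    right-left (P′⊆Q′ p′u) (P⊆Q pv)
  SameSplit⇒Separates (inj₂ ((P⊆Q′ , _) , (P′⊆Q , _))) (left-right pu p′v) =
    right-left (P⊆Q′ pu) (P′⊆Q p′v)
  SameSplit⇒Separates (inj₂ ((P⊆Q′ , _) , (P′⊆Q , _))) (right-left p′u pv) =
    left-right (P′⊆Q p′u) (P⊆Q′ pv)

module _ {T R : Tree} {L : Pred ℕ 0ℓ} (restriction : IsRestriction T L R) where

  private
    splitOfEdge = proj₁ (proj₂ restriction)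
    edgeOfSplit = proj₂ (proj₂ restriction)

  restriction-edge⇒tree-edge : ∀ {c d} → adj R c d ≡ true →
    ∃[ a ] ∃[ b ] (∀ {u v} → OnPath R u v c d → OnPath T u v a b)
  restriction-edge⇒tree-edge cd with splitOfEdge _ _ cd
  ... | a , b , ab , split =
    a , b , λ o → Separates⇒OnPath T ab
      (Separates-∩⁻ (SameSplit⇒Separates split (OnPath⇒Separates R o)))

  tree-edge⇒restriction-edge : ∀ {a b u₀ v₀} → OnPath T u₀ v₀ a b → L u₀ → L v₀ →
    ∃[ c ] ∃[ d ] (∀ {u v} → L u → L v → OnPath T u v a b → OnPath R u v c d)
  tree-edge⇒restriction-edge o Lu₀ Lv₀
    with Separates⇒Satisfiable (Separates-∩⁺ (OnPath⇒Separates T o) Lu₀ Lv₀)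
  ... | nonempty₁ , nonempty₂ with edgeOfSplit _ _ (OnPath⇒adj T o) nonempty₁ nonempty₂
  ... | c , d , cd , split =
    c , d , λ Lu Lv o′ → Separates⇒OnPath R cd
      (SameSplit⇒Separates (SameSplit-sym split) (Separates-∩⁺ (OnPath⇒Separates T o′) Lu Lv))

EdgeDisjoint⇔PathsDisjoint-restriction : ∀ (T R : Tree) {L₁ L₂ L′ : Pred ℕ 0ℓ} →
  (L₁ ∪ L₂) ⊆ L′ → IsRestriction T L′ R → EdgeDisjoint T L₁ L₂ ⇔ PathsDisjoint R L₁ L₂
EdgeDisjoint⇔PathsDisjoint-restriction T R {L₁} {L₂} {L′} L₁∪L₂⊆L′ restriction =
  mk⇔ preserves reflects
  where
  L₁⊆L′ : L₁ ⊆ L′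
  L₁⊆L′ l∈ = L₁∪L₂⊆L′ (inj₁ l∈)

  L₂⊆L′ : L₂ ⊆ L′
  L₂⊆L′ l∈ = L₁∪L₂⊆L′ (inj₂ l∈)

  preserves : EdgeDisjoint T L₁ L₂ → PathsDisjoint R L₁ L₂
  preserves disjoint u₁ v₁ u₂ v₂ u₁∈ v₁∈ u₂∈ v₂∈ c d (o₁ , o₂)
    with restriction-edge⇒tree-edge {T} {R} {L′} restriction (OnPath⇒adj R o₁)
  ... | a , b , lift = disjoint u₁ v₁ u₂ v₂ u₁∈ v₁∈ u₂∈ v₂∈ a b (lift o₁ , lift o₂)

  reflects : PathsDisjoint R L₁ L₂ → EdgeDisjoint T L₁ L₂
  reflects disjoint u₁ v₁ u₂ v₂ u₁∈ v₁∈ u₂∈ v₂∈ a b (o₁ , o₂)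
    with tree-edge⇒restriction-edge {T} {R} {L′} restriction o₁ (L₁⊆L′ u₁∈) (L₁⊆L′ v₁∈)
  ... | c , d , lift = disjoint u₁ v₁ u₂ v₂ u₁∈ v₁∈ u₂∈ v₂∈ c d
    (lift (L₁⊆L′ u₁∈) (L₁⊆L′ v₁∈) o₁ , lift (L₂⊆L′ u₂∈) (L₂⊆L′ v₂∈) o₂)

lemma7 : (T : Tree) → Binary T → (L₁ L₂ : Pred ℕ 0ℓ) → L₁ ⊆ ℒ T → L₂ ⊆ ℒ T →
    ((L' : Pred ℕ 0ℓ) → L' ⊆ ℒ T → (L₁ ∪ L₂) ⊆ L' →
       (R : Tree) → IsRestriction T L' R →
       EdgeDisjoint T L₁ L₂ ⇔ PathsDisjoint R L₁ L₂)
    × ((R : Tree) → IsRestriction T (L₁ ∪ L₂) R →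
       EdgeDisjoint T L₁ L₂ ⇔ PathsDisjoint R L₁ L₂)
lemma7 T _ L₁ L₂ _ _ =
  (λ L′ _ L₁∪L₂⊆L′ R → EdgeDisjoint⇔PathsDisjoint-restriction T R L₁∪L₂⊆L′) ,
  (λ R → EdgeDisjoint⇔PathsDisjoint-restriction T R id)
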